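{- Let $h\geq 2$ and let $\vec c=[c_1,\ldots,c_h]$ be an $h$-feasible color sequence with $2=c_1\leq c_2\leq\cdots\leq c_h$. Define integers $a_2,\ldots,a_h$ and $b_2,\ldots,b_h$ by $a_2=\lfloor c_2/2\rfloor$, $b_2=\lceil c_2/2\rceil$, and for $i=3,4,\ldots,h$: if $\sum_{j=2}^{i-1}a_j<\sum_{j=2}^{i-1}b_j$ then $a_i=\lceil c_i/2\rceil$ and $b_i=\lfloor c_i/2\rfloor$; otherwise $a_i=\lfloor c_i/2\rfloor$ and $b_i=\lceil c_i/2\rceil$. Then the sequences $(a_2,\ldots,a_h)$ and $(b_2,\ldots,b_h)$, after being sorted in non-decreasing order and regarded as sequences of length $h-1$, are both $(h-1)$-feasible color sequences.
   Context: A color sequence of dimension $d$ is a non-decreasing sequence of positive integers $x_1\leq\cdots\leq x_d$. It is $d$-feasible if (C1) $\sum_{i=1}^{\ell}x_i\geq\sum_{i=1}^{\ell}2^i$ for every $1\leq\ell\leq d$, and (C2) $\sum_{i=1}^{d}x_i=\sum_{i=1}^{d}2^i=2^{d+1}-2$. -}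

module Defs where

open import Data.Nat using (ℕ; zero; suc; _+_; _^_; _≤_; _<_; _∸_; ⌊_/2⌋; ⌈_/2⌉)
open import Data.Nat.Properties using (≤-decTotalOrder; _<?_)
open import Data.List using (List; []; _∷_; length; take; map)
open import Data.Nat.ListAction using (sum)
open import Data.List.Relation.Unary.All using (All)
open import Data.List.Relation.Unary.Sorted.TotalOrder as S using ()
open import Data.Product using (_×_; _,_; proj₁; proj₂)
open import Relation.Nullary using (does)
open import Data.Bool using (if_then_else_)
open import Relation.Binary.PropositionalEquality using (_≡_)
open import Data.Nat.Properties using (≤-totalOrder)

pow2sum : ℕ → ℕ
pow2sum zero    = 0
pow2sum (suc ℓ) = pow2sum ℓ + 2 ^ (suc ℓ)

IsColorSequence : List ℕ → Set
IsColorSequence xs = S.Sorted ≤-totalOrder xs × All (λ x → 1 ≤ x) xs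

Feasible : ℕ → List ℕ → Set
Feasible d xs =
  IsColorSequence xs ×
  length xs ≡ d ×
  ((ℓ : ℕ) → 1 ≤ ℓ → ℓ ≤ d → pow2sum ℓ ≤ sum (take ℓ xs)) ×
  sum xs ≡ pow2sum d

-- Given the running sums sa = Σ a_j, sb = Σ b_j of the previously defined
-- terms, process the remaining colours c_i (i ≥ 3) producing the pairs (a_i, b_i).
abStep : ℕ → ℕ → List ℕ → List (ℕ × ℕ)
abStep sa sb []       = []
abStep sa sb (c ∷ cs) =
  if does (sa <? sb)
  then (⌈ c /2⌉ , ⌊ c /2⌋) ∷ abStep (sa + ⌈ c /2⌉) (sb + ⌊ c /2⌋) cs
  else (⌊ c /2⌋ , ⌈ c /2⌉) ∷ abStep (sa + ⌊ c /2⌋) (sb + ⌈ c /2⌉) cs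

-- Input: the list [c_2, ..., c_h]. Output: [(a_2,b_2), ..., (a_h,b_h)].
abPairs : List ℕ → List (ℕ × ℕ)
abPairs []        = []
abPairs (c₂ ∷ cs) = (⌊ c₂ /2⌋ , ⌈ c₂ /2⌉) ∷ abStep ⌊ c₂ /2⌋ ⌈ c₂ /2⌉ cs

aSeq : List ℕ → List ℕ
aSeq cs = map proj₁ (abPairs cs)

bSeq : List ℕ → List ℕ
bSeq cs = map proj₂ (abPairs cs)

open import Data.List.Sort ≤-decTotalOrder public using (sort)

{-# OPTIONS --safe #-}
-- Write x for either of a and b.  Every x_i is ⌊c_i/2⌋ or ⌈c_i/2⌉, and the greedy rule keeps the
-- prefix sums of a and b within 1 of each other; hence c_i ≤ 2x_i + 1 and also C_j ≤ 2X_j + 1 for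
-- every prefix sum, and both totals are exactly half of Σ c_i = 2(2^h − 2).  Sorting only permutes,
-- so it suffices to show that every set S of ℓ indices has x-sum at least 2^(ℓ+1) − 2.  Let 1..k be
-- the longest initial segment contained in S.  If S is that segment, C_k ≥ 2(2^(k+1) − 2) and
-- C_k ≤ 2X_k + 1 suffice.  Otherwise index k+1 is skipped and m further indices follow; compare
-- with the prefix of length k+m+1 of c: if c_(k+1) is small, feasibility of that prefix gives the
-- bound, and if it is large, so is every c_i with i > k+1 (c is sorted), and the m further chosen
-- entries alone are enough.
module Submission where

open import Defs
open import Data.Nat using (ℕ; _≤_; _∸_)
open import Data.List using (List; _∷_)
open import Data.Product using (_×_)

open import Data.Bool using (true; false)
open import Data.List using ([]; length; take; map)
open import Data.List.Properties using (length-take; take-all)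
open import Data.List.Membership.Propositional using (_∈_)
open import Data.List.Relation.Binary.Pointwise using (Pointwise; []; _∷_)
open import Data.List.Relation.Binary.Pointwise.Properties using (Pointwise-length)
import Data.List.Relation.Binary.Permutation.Propositional as ↭
open ↭ using (_↭_)
open import Data.List.Relation.Binary.Permutation.Propositional.Properties using (↭-length)
open import Data.List.Relation.Binary.Sublist.Heterogeneous using (Sublist)
open import Data.List.Relation.Binary.Sublist.Heterogeneous.Properties as Sublist
  using (fromPointwise; length-mono-≤)
open import Data.List.Relation.Binary.Sublist.Propositional using (_⊆_; []; _∷_; _∷ʳ_; from∈)
open import Data.List.Relation.Binary.Sublist.Propositional.Properties using (take-⊆)
open import Data.List.Relation.Unary.All as All using (All; _∷_)
import Data.List.Relation.Unary.AllPairs as AllPairs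
open import Data.List.Relation.Unary.Linked using (Linked; [-]; _∷_; tail)
open import Data.List.Relation.Unary.Linked.Properties using (Linked⇒AllPairs)
open import Data.Nat using (zero; suc; _+_; _*_; _^_; _<ᵇ_; z≤n; s≤s; s≤s⁻¹; ⌊_/2⌋; ⌈_/2⌉)
open import Data.Nat.ListAction using (sum)
open import Data.Nat.ListAction.Properties using (sum-↭)
open import Data.Nat.Properties
open import Data.Nat.Tactic.RingSolver using (solve-∀)
open import Data.Product using (∃; _,_; proj₁; proj₂; swap)
open import Relation.Binary.PropositionalEquality
  using (_≡_; refl; sym; trans; cong; cong₂; subst; subst₂)
open import Relation.Nullary using (yes; no)
open import Relation.Nullary.Reflects using (ofʸ; ofⁿ)
open import Algebra.Properties.CommutativeSemigroup +-commutativeSemigroup using (interchange)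
open import Data.List.Sort ≤-decTotalOrder using (sort-↭; sort-↗)

2^suc≡2+pow2sum : ∀ n → 2 ^ suc n ≡ 2 + pow2sum n
2^suc≡2+pow2sum zero    = refl
2^suc≡2+pow2sum (suc n) rewrite 2^suc≡2+pow2sum n = identity (pow2sum n)
  where
  identity : ∀ p → 2 * (2 + p) ≡ 2 + (p + (2 + p))
  identity = solve-∀

pow2sum-suc : ∀ n → pow2sum (suc n) ≡ 2 + 2 * pow2sum n
pow2sum-suc n rewrite 2^suc≡2+pow2sum n = identity (pow2sum n)
  where
  identity : ∀ p → p + (2 + p) ≡ 2 + 2 * p
  identity = solve-∀

n≤pow2sum : ∀ n → n ≤ pow2sum n
n≤pow2sum zero    = z≤n
n≤pow2sum (suc n) rewrite pow2sum-suc n =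
  s≤s (≤-trans (n≤pow2sum n) (≤-trans (m≤m+n _ _) (n≤1+n _)))

-- AtLeastHalf x c says ⌊ c /2⌋ ≤ x.
AtLeastHalf : ℕ → ℕ → Set
AtLeastHalf x c = c ≤ 1 + 2 * x

2*m≤1+2*n⇒m≤n : ∀ {m n} → 2 * m ≤ 1 + 2 * n → m ≤ n
2*m≤1+2*n⇒m≤n {n = n} 2m≤1+2n = ≮⇒≥ λ n<m →
  1+n≰n (≤-trans (≤-reflexive (sym (*-suc 2 n))) (≤-trans (*-monoʳ-≤ 2 n<m) 2m≤1+2n))

Balanced : ℕ → ℕ → Set
Balanced a b = a ≤ 1 + b × b ≤ 1 + a

Balanced-sym : ∀ {a b} → Balanced a b → Balanced b a
Balanced-sym = swap

Balanced-+-cross : ∀ {a b x y} → a ≤ b → x ≤ y → Balanced a b → Balanced x y →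
  Balanced (a + y) (b + x)
Balanced-+-cross {b = b} {x} a≤b x≤y (_ , b≤1+a) (_ , y≤1+x) =
  ≤-trans (+-mono-≤ a≤b y≤1+x) (≤-reflexive (+-suc b x)) , +-mono-≤ b≤1+a x≤y

Balanced-+-assoc : ∀ {a b c x y z} → Balanced (a + b + c) (x + y + z) →
  Balanced (a + (b + c)) (x + (y + z))
Balanced-+-assoc {a} {b} {c} {x} {y} {z} = subst₂ Balanced (+-assoc a b c) (+-assoc x y z)

Halving : ℕ × ℕ → ℕ → Set
Halving (a , b) c = Balanced a b × a + b ≡ c

Halving-swap : ∀ {a b c} → Halving (a , b) c → Halving (b , a) c
Halving-swap {a} {b} (bal , a+b≡c) = Balanced-sym bal , trans (+-comm b a) a+b≡c

Halving⇒AtLeastHalf : ∀ {a b c} → Halving (a , b) c → AtLeastHalf a c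
Halving⇒AtLeastHalf {a} {b} ((_ , b≤1+a) , refl) = begin
  a + b        ≤⟨ +-monoʳ-≤ a b≤1+a ⟩
  a + (1 + a)  ≡⟨ identity a ⟩
  1 + 2 * a    ∎
  where
  open ≤-Reasoning
  identity : ∀ a → a + (1 + a) ≡ 1 + 2 * a
  identity = solve-∀

Halving-2*⇒≡ : ∀ {a b g} → Halving (a , b) (2 * g) → a ≡ g
Halving-2*⇒≡ {a} {b} {g} h@(_ , a+b≡2g) = ≤-antisym a≤g (half-bound h)
  where
  half-bound : ∀ {x y} → Halving (x , y) (2 * g) → g ≤ x
  half-bound h = 2*m≤1+2*n⇒m≤n (Halving⇒AtLeastHalf h)
  a≤g : a ≤ g
  a≤g = +-cancelˡ-≤ g a g (begin
    g + a  ≤⟨ +-monoˡ-≤ a (half-bound (Halving-swap h)) ⟩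
    b + a  ≡⟨ trans (+-comm b a) a+b≡2g ⟩
    2 * g  ≡⟨ cong (g +_) (+-identityʳ g) ⟩
    g + g  ∎)
    where open ≤-Reasoning

Balanced-⌊⌋⌈⌉ : ∀ c → Balanced ⌊ c /2⌋ ⌈ c /2⌉
Balanced-⌊⌋⌈⌉ c = ≤-trans (⌊n/2⌋≤⌈n/2⌉ c) (n≤1+n _) , ⌊n/2⌋-mono (n≤1+n (suc c))

halving-⌊⌋⌈⌉ : ∀ c → Halving (⌊ c /2⌋ , ⌈ c /2⌉) c
halving-⌊⌋⌈⌉ c = Balanced-⌊⌋⌈⌉ c , ⌊n/2⌋+⌈n/2⌉≡n c

abPairs≡abStep : ∀ cs → abPairs cs ≡ abStep 0 0 cs
abPairs≡abStep []      = refl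
abPairs≡abStep (_ ∷ _) = refl

-- The test does (sa <? sb) in abStep evaluates to sa <ᵇ sb, so that is what the proofs case on.
abStep-halving : ∀ sa sb cs → Pointwise Halving (abStep sa sb cs) cs
abStep-halving sa sb []       = []
abStep-halving sa sb (c ∷ cs) with sa <ᵇ sb | <ᵇ-reflects-< sa sb
... | true  | ofʸ _ = Halving-swap (halving-⌊⌋⌈⌉ c) ∷ abStep-halving _ _ cs
... | false | ofⁿ _ = halving-⌊⌋⌈⌉ c ∷ abStep-halving _ _ cs

abStep-balanced : ∀ {sa sb} cs → Balanced sa sb → ∀ j →
  Balanced (sa + sum (take j (map proj₁ (abStep sa sb cs))))
           (sb + sum (take j (map proj₂ (abStep sa sb cs))))
abStep-balanced {sa} {sb} _        bal zero    =
  subst₂ Balanced (sym (+-identityʳ sa)) (sym (+-identityʳ sb)) bal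
abStep-balanced           []       bal (suc j) = abStep-balanced [] bal zero
abStep-balanced {sa} {sb} (c ∷ cs) bal (suc j) with sa <ᵇ sb | <ᵇ-reflects-< sa sb
... | true  | ofʸ sa<sb = Balanced-+-assoc {sa} {x = sb} (abStep-balanced cs
  (Balanced-+-cross (<⇒≤ sa<sb) (⌊n/2⌋≤⌈n/2⌉ c) bal (Balanced-⌊⌋⌈⌉ c)) j)
... | false | ofⁿ sa≮sb = Balanced-+-assoc {sa} {x = sb} (abStep-balanced cs
  (Balanced-sym (Balanced-+-cross (≮⇒≥ sa≮sb) (⌊n/2⌋≤⌈n/2⌉ c) (Balanced-sym bal) (Balanced-⌊⌋⌈⌉ c)))
  j)

halving-prefix-sums : ∀ {ps cs} → Pointwise Halving ps cs → ∀ j →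
  sum (take j (map proj₁ ps)) + sum (take j (map proj₂ ps)) ≡ sum (take j cs)
halving-prefix-sums _  zero    = refl
halving-prefix-sums [] (suc j) = refl
halving-prefix-sums {(a , b) ∷ ps} ((_ , a+b≡c) ∷ hs) (suc j) =
  trans (interchange a _ b _) (cong₂ _+_ a+b≡c (halving-prefix-sums hs j))

record Splits (cs xs ys : List ℕ) : Set where
  field
    halfˡ    : Pointwise AtLeastHalf xs cs
    halfʳ    : Pointwise AtLeastHalf ys cs
    prefixes : ∀ j → Halving (sum (take j xs) , sum (take j ys)) (sum (take j cs))

  whole : Halving (sum xs , sum ys) (sum cs)
  whole = subst₂ (λ u v → Halving (sum u , sum v) (sum cs))
            (take-all n xs (shorter halfˡ)) (take-all n ys (shorter halfʳ))
            (subst (λ w → Halving (sum (take n xs) , sum (take n ys)) (sum w))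
              (take-all n cs ≤-refl) (prefixes n))
    where
    n = length cs
    shorter : ∀ {zs} → Pointwise AtLeastHalf zs cs → length zs ≤ n
    shorter hs = ≤-reflexive (Pointwise-length hs)

Splits-sym : ∀ {cs xs ys} → Splits cs xs ys → Splits cs ys xs
Splits-sym s = record { halfˡ = halfʳ ; halfʳ = halfˡ ; prefixes = λ j → Halving-swap (prefixes j) }
  where open Splits s

abPairs-splits : ∀ cs → Splits cs (aSeq cs) (bSeq cs)
abPairs-splits cs rewrite abPairs≡abStep cs = record
  { halfˡ    = projected Halving⇒AtLeastHalf halving
  ; halfʳ    = projected (λ h → Halving⇒AtLeastHalf (Halving-swap h)) halving
  ; prefixes = λ j → abStep-balanced cs (z≤n , z≤n) j , halving-prefix-sums halving j
  }
  where
  halving = abStep-halving 0 0 cs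
  projected : ∀ {f ps cs} → (∀ {a b c} → Halving (a , b) c → AtLeastHalf (f (a , b)) c) →
              Pointwise Halving ps cs → Pointwise AtLeastHalf (map f ps) cs
  projected h []       = []
  projected h (p ∷ hs) = h p ∷ projected h hs

sum-take-∷-≤ : ∀ {c cs} m → Linked _≤_ (c ∷ cs) → m ≤ length cs →
  sum (take m (c ∷ cs)) ≤ sum (take m cs)
sum-take-∷-≤ zero    _              _         = ≤-refl
sum-take-∷-≤ (suc m) [-]            ()
sum-take-∷-≤ (suc m) (c≤d ∷ sorted) (s≤s m≤n) = +-mono-≤ c≤d (sum-take-∷-≤ m sorted m≤n)

*-≤-sum-take : ∀ {c cs} m → All (c ≤_) cs → m ≤ length cs → m * c ≤ sum (take m cs)
*-≤-sum-take zero    _            _         = z≤n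
*-≤-sum-take (suc m) (c≤d ∷ c≤cs) (s≤s m≤n) = +-mono-≤ c≤d (*-≤-sum-take m c≤cs m≤n)

sum-take-≤-sublist : ∀ {S cs} → Linked _≤_ cs → Sublist AtLeastHalf S cs →
  sum (take (length S) cs) ≤ length S + 2 * sum S
sum-take-≤-sublist _ [] = z≤n
sum-take-≤-sublist sorted (_ ∷ʳ σ) =
  ≤-trans (sum-take-∷-≤ _ sorted (length-mono-≤ σ)) (sum-take-≤-sublist (tail sorted) σ)
sum-take-≤-sublist {s ∷ S} {c ∷ cs} sorted (c≤1+2s ∷ σ) = begin
  c + sum (take (length S) cs)        ≤⟨ +-mono-≤ c≤1+2s (sum-take-≤-sublist (tail sorted) σ) ⟩
  1 + 2 * s + (length S + 2 * sum S)  ≡⟨ identity s (length S) (sum S) ⟩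
  suc (length S) + 2 * (s + sum S)    ∎
  where
  open ≤-Reasoning
  identity : ∀ s l t → 1 + 2 * s + (l + 2 * t) ≡ suc l + 2 * (s + t)
  identity = solve-∀

bound-if-skipped-small : ∀ {g P X s c R m} → c + m ≤ 3 + 2 * g → 2 * (2 + 2 * g) ≤ P + (c + R) →
  P ≤ 1 + 2 * X → R ≤ m + 2 * s → g ≤ X + s
bound-if-skipped-small {g} {P} {X} {s} {c} {R} {m} small prefix P≤1+2X R≤m+2s =
  *-cancelˡ-≤ 2 (+-cancelʳ-≤ (4 + 2 * g) (2 * g) (2 * (X + s)) (begin
    2 * g + (4 + 2 * g)              ≡⟨ identity₁ g ⟩
    2 * (2 + 2 * g)                  ≤⟨ prefix ⟩
    P + (c + R)                      ≤⟨ +-mono-≤ P≤1+2X (+-monoʳ-≤ c R≤m+2s) ⟩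
    1 + 2 * X + (c + (m + 2 * s))    ≡⟨ identity₂ X s c m ⟩
    2 * (X + s) + (1 + (c + m))      ≤⟨ +-monoʳ-≤ (2 * (X + s)) (s≤s small) ⟩
    2 * (X + s) + (4 + 2 * g)        ∎))
  where
  open ≤-Reasoning
  identity₁ : ∀ g → 2 * g + (4 + 2 * g) ≡ 2 * (2 + 2 * g)
  identity₁ = solve-∀
  identity₂ : ∀ X s c m → 1 + 2 * X + (c + (m + 2 * s)) ≡ 2 * (X + s) + (1 + (c + m))
  identity₂ = solve-∀

bound-if-skipped-large : ∀ {g s c R n} → suc n ≤ g → 4 + 2 * g ≤ c + suc n →
  R ≤ suc n + 2 * s → suc n * c ≤ R → g ≤ s
bound-if-skipped-large {g} {s} {c} {R} {n} m≤g large R≤m+2s mc≤R =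
  *-cancelˡ-≤ 2 (≤-trans (m≤n+m (2 * g) 2) (+-cancelʳ-≤ (suc n) (2 + 2 * g) (2 * s) (begin
    2 + 2 * g + suc n  ≡⟨ +-suc (2 + 2 * g) n ⟩
    3 + 2 * g + n      ≤⟨ s≤s⁻¹ (≤-trans (+-monoˡ-≤ n large) (≤-reflexive (identity c n))) ⟩
    c + n * 2          ≤⟨ +-monoʳ-≤ c (*-monoʳ-≤ n 2≤c) ⟩
    suc n * c          ≤⟨ mc≤R ⟩
    R                  ≤⟨ R≤m+2s ⟩
    suc n + 2 * s      ≡⟨ +-comm (suc n) (2 * s) ⟩
    2 * s + suc n      ∎)))
  where
  open ≤-Reasoning
  4+g≤c : 4 + g ≤ c
  4+g≤c = +-cancelʳ-≤ g (4 + g) c (begin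
    4 + g + g   ≡⟨ cong (λ t → 4 + (g + t)) (+-identityʳ g) ⟨
    4 + 2 * g   ≤⟨ large ⟩
    c + suc n   ≤⟨ +-monoʳ-≤ c m≤g ⟩
    c + g       ∎)
  2≤c : 2 ≤ c
  2≤c = ≤-trans (s≤s (s≤s z≤n)) 4+g≤c
  identity : ∀ c n → c + suc n + n ≡ suc (c + n * 2)
  identity = solve-∀

-- The first k indices of a chosen set have c-sum P and x-sum X, index k+1 (value c) is skipped,
-- and the other m = suc n chosen indices have x-sum s; R is the sum of the m entries of the
-- sorted c after c itself, and g = pow2sum (k + m).
bound-if-skipped : ∀ {g P X s c R n} → suc n ≤ g → 2 * (2 + 2 * g) ≤ P + (c + R) →
  P ≤ 1 + 2 * X → R ≤ suc n + 2 * s → suc n * c ≤ R → g ≤ X + s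
bound-if-skipped {g} {X = X} {s} {c} {n = n} m≤g prefix P≤1+2X R≤m+2s mc≤R with c + suc n ≤? 3 + 2 * g
... | yes small = bound-if-skipped-small {g} {X = X} {s} small prefix P≤1+2X R≤m+2s
... | no  large = ≤-trans (bound-if-skipped-large m≤g (≰⇒> large) R≤m+2s mc≤R) (m≤n+m s X)

-- S is the rest of a chosen sublist whose part so far is a prefix of length k, with c-sum P and
-- x-sum X.
pow2sum≤sum-sublist :
  ∀ {k P X cs xs S} → Linked _≤_ cs → Pointwise AtLeastHalf xs cs →
  (∀ j → AtLeastHalf (X + sum (take j xs)) (P + sum (take j cs))) →
  (∀ j → j ≤ length cs → 2 * pow2sum (k + j) ≤ P + sum (take j cs)) →
  S ⊆ xs → pow2sum (k + length S) ≤ X + sum S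
pow2sum≤sum-sublist {S = []} _ _ half large _ = 2*m≤1+2*n⇒m≤n (≤-trans (large 0 z≤n) (half 0))
pow2sum≤sum-sublist {k} {P} {X} {c ∷ cs} {x ∷ xs} {x ∷ S} sorted (_ ∷ halves) half large (refl ∷ σ) =
  subst₂ (λ i t → pow2sum i ≤ t) (sym (+-suc k (length S))) (+-assoc X x (sum S))
    (pow2sum≤sum-sublist {suc k} {P + c} {X + x} (tail sorted) halves half′ large′ σ)
  where
  half′ : ∀ j → AtLeastHalf (X + x + sum (take j xs)) (P + c + sum (take j cs))
  half′ j = subst₂ AtLeastHalf (sym (+-assoc X x _)) (sym (+-assoc P c _)) (half (suc j))
  large′ : ∀ j → j ≤ length cs → 2 * pow2sum (suc k + j) ≤ P + c + sum (take j cs)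
  large′ j j≤n = subst₂ (λ i t → 2 * pow2sum i ≤ t) (+-suc k j) (sym (+-assoc P c _))
                   (large (suc j) (s≤s j≤n))
pow2sum≤sum-sublist {k} {P} {X} {c ∷ cs} {x ∷ xs} {S@(_ ∷ _)} sorted (_ ∷ halves) half large
                    (_ ∷ʳ σ) =
  bound-if-skipped {X = X} {sum S} m≤g prefix P≤1+2X matched smallest
  where
  m = length S
  τ : Sublist AtLeastHalf S cs
  τ = Sublist.trans (λ { refl h → h }) σ (fromPointwise halves)
  m≤n : m ≤ length cs
  m≤n = length-mono-≤ τ
  m≤g : m ≤ pow2sum (k + m)
  m≤g = ≤-trans (m≤n+m m k) (n≤pow2sum (k + m))
  prefix : 2 * (2 + 2 * pow2sum (k + m)) ≤ P + (c + sum (take m cs))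
  prefix = subst (λ t → 2 * t ≤ P + (c + sum (take m cs)))
             (trans (cong pow2sum (+-suc k m)) (pow2sum-suc (k + m))) (large (suc m) (s≤s m≤n))
  P≤1+2X : P ≤ 1 + 2 * X
  P≤1+2X = subst₂ AtLeastHalf (+-identityʳ X) (+-identityʳ P) (half 0)
  matched : sum (take m cs) ≤ m + 2 * sum S
  matched = sum-take-≤-sublist (tail sorted) τ
  smallest : m * c ≤ sum (take m cs)
  smallest = *-≤-sum-take m (AllPairs.head (Linked⇒AllPairs ≤-trans sorted)) m≤n

⊆-↭⇒↭-⊆ : ∀ {A : Set} {zs ys xs : List A} → zs ⊆ ys → ys ↭ xs →
  ∃ λ zs′ → zs ↭ zs′ × zs′ ⊆ xs
⊆-↭⇒↭-⊆ σ ↭.refl = _ , ↭.refl , σ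
⊆-↭⇒↭-⊆ (y ∷ʳ σ) (↭.prep y p) =
  let zs′ , q , τ = ⊆-↭⇒↭-⊆ σ p in zs′ , q , y ∷ʳ τ
⊆-↭⇒↭-⊆ (refl ∷ σ) (↭.prep y p) =
  let zs′ , q , τ = ⊆-↭⇒↭-⊆ σ p in y ∷ zs′ , ↭.prep y q , refl ∷ τ
⊆-↭⇒↭-⊆ (x ∷ʳ y ∷ʳ σ) (↭.swap x y p) =
  let zs′ , q , τ = ⊆-↭⇒↭-⊆ σ p in zs′ , q , y ∷ʳ x ∷ʳ τ
⊆-↭⇒↭-⊆ (x ∷ʳ refl ∷ σ) (↭.swap x y p) =
  let zs′ , q , τ = ⊆-↭⇒↭-⊆ σ p in y ∷ zs′ , ↭.prep y q , refl ∷ x ∷ʳ τ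
⊆-↭⇒↭-⊆ (refl ∷ y ∷ʳ σ) (↭.swap x y p) =
  let zs′ , q , τ = ⊆-↭⇒↭-⊆ σ p in x ∷ zs′ , ↭.prep x q , y ∷ʳ refl ∷ τ
⊆-↭⇒↭-⊆ (refl ∷ refl ∷ σ) (↭.swap x y p) =
  let zs′ , q , τ = ⊆-↭⇒↭-⊆ σ p in y ∷ x ∷ zs′ , ↭.swap x y q , refl ∷ refl ∷ τ
⊆-↭⇒↭-⊆ σ (↭.trans p₁ p₂) =
  let zs₁ , q₁ , τ₁ = ⊆-↭⇒↭-⊆ σ p₁
      zs₂ , q₂ , τ₂ = ⊆-↭⇒↭-⊆ τ₁ p₂
  in zs₂ , ↭.trans q₁ q₂ , τ₂

sort-feasible : ∀ {cs xs ys} → Linked _≤_ cs →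
  (∀ j → j ≤ length cs → 2 * pow2sum j ≤ sum (take j cs)) →
  sum cs ≡ 2 * pow2sum (length cs) →
  Splits cs xs ys → Feasible (length cs) (sort xs)
sort-feasible {cs} {xs} sorted large total s =
  (sort-↗ xs , All.tabulate positive) , length-sort , prefix ,
  trans (sum-↭ (sort-↭ xs)) (Halving-2*⇒≡ (subst (λ t → Halving _ t) total whole))
  where
  open Splits s
  n = length cs
  length-sort : length (sort xs) ≡ n
  length-sort = trans (↭-length (sort-↭ xs)) (Pointwise-length halfˡ)
  sublist-bound : ∀ {T} → T ⊆ sort xs → pow2sum (length T) ≤ sum T
  sublist-bound τ =
    let T′ , T↭T′ , T′⊆xs = ⊆-↭⇒↭-⊆ τ (sort-↭ xs)
    in subst₂ (λ l t → pow2sum l ≤ t) (sym (↭-length T↭T′)) (sym (sum-↭ T↭T′))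
         (pow2sum≤sum-sublist {0} {0} {0} sorted halfˡ (λ j → Halving⇒AtLeastHalf (prefixes j))
           large T′⊆xs)
  positive : ∀ {x} → x ∈ sort xs → 1 ≤ x
  positive {x} x∈ =
    ≤-trans (s≤s z≤n) (≤-trans (sublist-bound (from∈ x∈)) (≤-reflexive (+-identityʳ x)))
  prefix : ∀ ℓ → 1 ≤ ℓ → ℓ ≤ n → pow2sum ℓ ≤ sum (take ℓ (sort xs))
  prefix ℓ _ ℓ≤n = subst (λ l → pow2sum l ≤ sum (take ℓ (sort xs)))
    (trans (length-take ℓ (sort xs)) (m≤n⇒m⊓n≡m (≤-trans ℓ≤n (≤-reflexive (sym length-sort)))))
    (sublist-bound (take-⊆ ℓ (sort xs)))

lemma5 : (h : ℕ) → 2 ≤ h → (cs : List ℕ) →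
    Feasible h (2 ∷ cs) →
    Feasible (h ∸ 1) (sort (aSeq cs)) × Feasible (h ∸ 1) (sort (bSeq cs))
lemma5 _ _ cs ((sorted , _) , refl , prefix , total) =
  sort-feasible (tail sorted) large half-total splits ,
  sort-feasible (tail sorted) large half-total (Splits-sym splits)
  where
  splits = abPairs-splits cs
  large : ∀ j → j ≤ length cs → 2 * pow2sum j ≤ sum (take j cs)
  large j j≤n = +-cancelˡ-≤ 2 _ _
    (subst (_≤ 2 + sum (take j cs)) (pow2sum-suc j) (prefix (suc j) (s≤s z≤n) (s≤s j≤n)))
  half-total : sum cs ≡ 2 * pow2sum (length cs)
  half-total = +-cancelˡ-≡ 2 _ _ (trans total (pow2sum-suc (length cs)))
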